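{- For every formula $\phi$ of a first-order language $L$, every subject-dependent $L$-structure $\mathcal{M}$, and all states $\mathrm{e}$ and $\mathrm{e}'$ of $\mathcal{M}$: if $\mathrm{e}\leq \mathrm{e}'$ and $(\mathcal{M},\mathrm{e})\models \phi$, then $(\mathcal{M},\mathrm{e}')\models \phi$.
   Context: Setting. For a set $D$, $D^\ast$ is the set of finite sequences (strings) over $D$; $\lambda$ is the empty string; $\mathrm{s}\leq\mathrm{t}$ means $\mathrm{t}=\mathrm{s}\mathrm{v}$ for some string $\mathrm{v}$ (concatenation). For a string $\mathrm{s}=\langle d_1,\dots,d_k\rangle$ and a set $A$, $F_\mathrm{s}(A)$ is the set of functions $\{d_1,\dots,d_k\}\to A$. A non-predetermined function $f:D\hookrightarrow A$ is a map $H$ assigning to each $\mathrm{s}\in D^\ast$ a function $H[\mathrm{s}]\in F_\mathrm{s}(A)$ such that extending $\mathrm{s}$ by one element does not change the values on $d_1,\dots,d_k$. A first-order language $L$ has finitely many predicate symbols $R_i$ ($i\le m_1$) and function symbols $f_i$ ($i\le m_0$), each with an arity $n_i$, and a set of constant symbols. A subject-dependent $L$-structure $\mathcal{M}$ consists of a universe $M$, non-predetermined functions $f_i^{\mathcal{M}}:M^{n_i}\hookrightarrow M$ (with associated maps $H_i$), non-predetermined functions $R_i^{\mathcal{M}}:M^{n_i}\hookrightarrow\{0,1\}$ (with associated maps $H'_i$), and distinguished elements $c^{\mathcal{M}}$ for the constants. A state is $\mathrm{e}=([\mathrm{s}_0,\dots,\mathrm{s}_{m_0}],[\mathrm{s}'_0,\dots,\mathrm{s}'_{m_1}])$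 with $\mathrm{s}_i,\mathrm{s}'_i$ strings over $M^{n_i}$; querying $f_i$ (resp. $R_i$) at $d$ appends $d$ to $\mathrm{s}_i$ (resp. $\mathrm{s}'_i$). For states $\mathrm{e}$, $\mathrm{e}'$ (with strings $\mathrm{l}_i,\mathrm{l}'_i$), $\mathrm{e}\leq\mathrm{e}'$ means $\mathrm{s}_i\leq\mathrm{l}_i$ and $\mathrm{s}'_i\leq\mathrm{l}'_i$ for all $i$. In state $\mathrm{e}$, $f_i$ at $d$ is determined iff $d$ occurs in $\mathrm{s}_i$, with value $H_i[\mathrm{s}_i](d)$; likewise $R_i$ at $d$ is determined iff $d$ occurs in $\mathrm{s}'_i$, with value $H'_i[\mathrm{s}'_i](d)$. Term values $t^{\mathrm{e}}(\bar a)$ are determined inductively (constants and variables always; $f_i(t_1,\dots,t_{n_i})$ iff all $t_j$ are determined and the tuple of their values occurs in $\mathrm{s}_i$). Formulas are built from $t_1=t_2$, $R_i(t_1,\dots,t_{n_i})$ with $\neg,\wedge,\vee,\rightarrow,\forall,\exists$. Satisfaction $(\mathcal{M},\mathrm{e})\models\varphi(\bar a)$ is defined by: $t_1=t_2$ holds iff for all $\mathrm{e}'\ge\mathrm{e}$ at which both terms are determined, their values agree; $R_i(\bar t)$ holds iff for all $\mathrm{e}'\ge\mathrm{e}$ at which the terms and $R_i$ at their values are determined, the value is $1$; $\neg\psi$ holds iff $(\mathcal{M},\mathrm{e}')\not\models\psi$ for all $\mathrm{e}'\ge\mathrm{e}$; $\psi\wedge\theta$ (resp. $\psi\vee\theta$)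 holds iff both (resp. at least one) of: for all $\mathrm{e}'\ge\mathrm{e}$ at which the atomic subformulas of $\psi$ (resp. $\theta$) are determined, $(\mathcal{M},\mathrm{e}')\models\psi$ (resp. $\theta$); $\exists x\psi$ (resp. $\forall x\psi$) holds iff for some (resp. every) $b\in M$, for all $\mathrm{e}'\ge\mathrm{e}$ at which the atomic subformulas of $\psi(\bar a,b)$ are determined, $(\mathcal{M},\mathrm{e}')\models\psi(\bar a,b)$; $\psi\rightarrow\theta$ holds iff for all $\mathrm{e}'\ge\mathrm{e}$ at which the atomic subformulas of both $\psi$ and $\theta$ are determined, $(\mathcal{M},\mathrm{e}')\models\psi$ implies $(\mathcal{M},\mathrm{e}')\models\theta$. -}

module Defs where

open import Data.Nat using (ℕ; suc)
open import Data.Fin using (Fin)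
open import Data.Bool using (Bool; true)
open import Data.List using (List; []; _∷_; _++_; [_])
open import Data.List.Membership.Propositional using (_∈_)
open import Data.Vec using (Vec; []; _∷_; lookup)
open import Data.Product using (Σ; ∃; _×_; _,_)
open import Data.Sum using (_⊎_)
open import Data.Empty using (⊥)
open import Relation.Binary.PropositionalEquality using (_≡_)
open import Relation.Nullary using (¬_)

_≼_ : {D : Set} → List D → List D → Set
s ≼ t = ∃ λ v → t ≡ s ++ v

-- H s is an element of F_s(A),
-- represented as a total function D → A of which only the values on the
-- elements occurring in s are ever used.
record NPF (D A : Set) : Set where
  field
    H      : List D → D → A
    stable : ∀ (s : List D) (d x : D) → d ∈ s → H (s ++ [ x ]) d ≡ H s d

open NPF public

record Language : Set₁ where
  field
    m₀       : ℕ
    funArity : Fin (suc m₀) → ℕ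
    m₁       : ℕ
    relArity : Fin (suc m₁) → ℕ
    Const    : Set

open Language public

record Structure (L : Language) : Set₁ where
  field
    M     : Set
    fun   : (i : Fin (suc (m₀ L))) → NPF (Vec M (funArity L i)) M
    rel   : (i : Fin (suc (m₁ L))) → NPF (Vec M (relArity L i)) Bool
    const : Const L → M

open Structure public

module _ (L : Language) where

  mutual
    data Term (n : ℕ) : Set where
      var  : Fin n → Term n
      con  : Const L → Term n
      app  : (i : Fin (suc (m₀ L))) → Terms n (funArity L i) → Term n

    data Terms (n : ℕ) : ℕ → Set where
      []  : Terms n 0
      _∷_ : ∀ {k} → Term n → Terms n k → Terms n (suc k)

  data Formula (n : ℕ) : Set where
    _≐_  : Term n → Term n → Formula n
    R'   : (i : Fin (suc (m₁ L))) → Terms n (relArity L i) → Formula n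
    ¬'_  : Formula n → Formula n
    _∧'_ : Formula n → Formula n → Formula n
    _∨'_ : Formula n → Formula n → Formula n
    _⇒'_ : Formula n → Formula n → Formula n
    ∀'   : Formula (suc n) → Formula n
    ∃'   : Formula (suc n) → Formula n

module _ {L : Language} (𝓜 : Structure L) where

  record State : Set where
    field
      fs : (i : Fin (suc (m₀ L))) → List (Vec (M 𝓜) (funArity L i))
      rs : (i : Fin (suc (m₁ L))) → List (Vec (M 𝓜) (relArity L i))

  open State public

  _≤ₛ_ : State → State → Set
  e ≤ₛ e' = (∀ i → fs e i ≼ fs e' i) × (∀ i → rs e i ≼ rs e' i)

  -- TermVal e a t v : in state e, under assignment a, the term t is
  -- determined and has value v.
  mutual
    data TermVal (e : State) {n : ℕ} (a : Vec (M 𝓜) n) : Term L n → M 𝓜 → Set where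
      var : ∀ j → TermVal e a (var j) (lookup a j)
      con : ∀ c → TermVal e a (con c) (const 𝓜 c)
      app : ∀ i {ts} {vs} → TermsVal e a ts vs → vs ∈ fs e i
            → TermVal e a (app i ts) (H (fun 𝓜 i) (fs e i) vs)

    data TermsVal (e : State) {n : ℕ} (a : Vec (M 𝓜) n) : ∀ {k} → Terms L n k → Vec (M 𝓜) k → Set where
      []  : TermsVal e a [] []
      _∷_ : ∀ {k t v} {ts : Terms L n k} {vs} → TermVal e a t v → TermsVal e a ts vs
            → TermsVal e a (t ∷ ts) (v ∷ vs)

  AtomsDet : State → ∀ {n} → Formula L n → Vec (M 𝓜) n → Set
  AtomsDet e (t₁ ≐ t₂) a = (∃ λ v₁ → TermVal e a t₁ v₁) × (∃ λ v₂ → TermVal e a t₂ v₂)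
  AtomsDet e (R' i ts) a = ∃ λ vs → TermsVal e a ts vs × vs ∈ rs e i
  AtomsDet e (¬' φ) a = AtomsDet e φ a
  AtomsDet e (φ ∧' ψ) a = AtomsDet e φ a × AtomsDet e ψ a
  AtomsDet e (φ ∨' ψ) a = AtomsDet e φ a × AtomsDet e ψ a
  AtomsDet e (φ ⇒' ψ) a = AtomsDet e φ a × AtomsDet e ψ a
  AtomsDet e (∀' φ) a = ∀ b → AtomsDet e φ (b ∷ a)
  AtomsDet e (∃' φ) a = ∀ b → AtomsDet e φ (b ∷ a)

  Sat : State → ∀ {n} → Formula L n → Vec (M 𝓜) n → Set
  Sat e (t₁ ≐ t₂) a = ∀ e' → e ≤ₛ e' → ∀ {v₁ v₂} → TermVal e' a t₁ v₁ → TermVal e' a t₂ v₂ → v₁ ≡ v₂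
  Sat e (R' i ts) a = ∀ e' → e ≤ₛ e' → ∀ {vs} → TermsVal e' a ts vs → vs ∈ rs e' i
                       → H (rel 𝓜 i) (rs e' i) vs ≡ true
  Sat e (¬' φ) a = ∀ e' → e ≤ₛ e' → ¬ Sat e' φ a
  Sat e (φ ∧' ψ) a = (∀ e' → e ≤ₛ e' → AtomsDet e' φ a → Sat e' φ a)
                   × (∀ e' → e ≤ₛ e' → AtomsDet e' ψ a → Sat e' ψ a)
  Sat e (φ ∨' ψ) a = (∀ e' → e ≤ₛ e' → AtomsDet e' φ a → Sat e' φ a)
                   ⊎ (∀ e' → e ≤ₛ e' → AtomsDet e' ψ a → Sat e' ψ a)
  Sat e (φ ⇒' ψ) a = ∀ e' → e ≤ₛ e' → AtomsDet e' φ a → AtomsDet e' ψ a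
                     → Sat e' φ a → Sat e' ψ a
  Sat e (∀' φ) a = ∀ b → ∀ e' → e ≤ₛ e' → AtomsDet e' φ (b ∷ a) → Sat e' φ (b ∷ a)
  Sat e (∃' φ) a = Σ (M 𝓜) λ b → ∀ e' → e ≤ₛ e' → AtomsDet e' φ (b ∷ a) → Sat e' φ (b ∷ a)

module Submission where

-- Every clause of the satisfaction relation is built from the "from now on"
-- modality: a property Q holds from now on at e when Q holds at every state
-- e' ≥ e.  Atomic formulas, negation, implication and ∀ are single instances
-- of this modality; ∧, ∨ and ∃ are a pair, a choice and a witness of such
-- instances.  Because the order on states is transitive, a property that holds
-- from now on at e also holds from now on at every later state.

open import Defs
open import Data.Nat using (ℕ)
open import Data.Vec using (Vec)
open import Data.List using (List; _++_)
open import Data.List.Properties using (++-assoc)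
open import Data.Product using (_,_)
open import Data.Sum using (inj₁; inj₂)
open import Relation.Binary.PropositionalEquality using (refl)

≼-trans : {D : Set} {s t u : List D} → s ≼ t → t ≼ u → s ≼ u
≼-trans {s = s} (v , refl) (w , refl) = v ++ w , ++-assoc s v w

module _ {L : Language} (𝓜 : Structure L) where

  ≤ₛ-trans : {e₁ e₂ e₃ : State 𝓜} → _≤ₛ_ 𝓜 e₁ e₂ → _≤ₛ_ 𝓜 e₂ e₃ → _≤ₛ_ 𝓜 e₁ e₃
  ≤ₛ-trans (fs₁₂ , rs₁₂) (fs₂₃ , rs₂₃) =
    (λ i → ≼-trans (fs₁₂ i) (fs₂₃ i)) , (λ i → ≼-trans (rs₁₂ i) (rs₂₃ i))

  FromNowOn : (State 𝓜 → Set) → State 𝓜 → Set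
  FromNowOn Q e = ∀ e' → _≤ₛ_ 𝓜 e e' → Q e'

  fromNowOn-persists : {Q : State 𝓜 → Set} {e e' : State 𝓜}
    → _≤ₛ_ 𝓜 e e' → FromNowOn Q e → FromNowOn Q e'
  fromNowOn-persists e≤e' Q-from-e e'' e'≤e'' = Q-from-e e'' (≤ₛ-trans e≤e' e'≤e'')

-- Each satisfaction clause unfolds definitionally to FromNowOn Q, with Q the
-- property under its quantifier over later states (or to a pair, a choice or
-- a witness of such), so it persists by fromNowOn-persists; Q is inferred.
mainTheorem1 : (L : Language) (𝓜 : Structure L) {n : ℕ} (φ : Formula L n)
    (a : Vec (M 𝓜) n) (e e' : State 𝓜)
    → _≤ₛ_ 𝓜 e e' → Sat 𝓜 e φ a → Sat 𝓜 e' φ a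
mainTheorem1 _ 𝓜 (_ ≐ _) _ _ _ e≤e' sat = fromNowOn-persists 𝓜 e≤e' sat
mainTheorem1 _ 𝓜 (R' _ _) _ _ _ e≤e' sat = fromNowOn-persists 𝓜 e≤e' sat
mainTheorem1 _ 𝓜 (¬' _) _ _ _ e≤e' sat = fromNowOn-persists 𝓜 e≤e' sat
mainTheorem1 _ 𝓜 (_ ∧' _) _ _ _ e≤e' (sat-left , sat-right) =
  fromNowOn-persists 𝓜 e≤e' sat-left , fromNowOn-persists 𝓜 e≤e' sat-right
mainTheorem1 _ 𝓜 (_ ∨' _) _ _ _ e≤e' (inj₁ sat-left) = inj₁ (fromNowOn-persists 𝓜 e≤e' sat-left)
mainTheorem1 _ 𝓜 (_ ∨' _) _ _ _ e≤e' (inj₂ sat-right) = inj₂ (fromNowOn-persists 𝓜 e≤e' sat-right)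
mainTheorem1 _ 𝓜 (_ ⇒' _) _ _ _ e≤e' sat = fromNowOn-persists 𝓜 e≤e' sat
mainTheorem1 _ 𝓜 (∀' _) _ _ _ e≤e' sat = λ b → fromNowOn-persists 𝓜 e≤e' (sat b)
mainTheorem1 _ 𝓜 (∃' _) _ _ _ e≤e' (b , sat-b) = b , fromNowOn-persists 𝓜 e≤e' sat-b
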